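{- For any graph $G$ of order $n$, $n+1\leqslant \chi_{\square}(G)+\chi_{\square}(\overline{G})\leqslant 2n$; equivalently, $n+1\leqslant \chi(G^2)+\chi(\overline{G}^2)\leqslant 2n$.
   Context: All graphs are finite and simple; the order of a graph is its number of vertices, and $\overline{G}$ denotes the complement of $G$. For a graph $G$, $d(u,v)$ is the length of a shortest $(u,v)$-path in $G$. A mapping $f:V(G)\to\{1,\ldots,k\}$ is a square $k$-coloring of $G$ if $f(u)\neq f(v)$ whenever $u\neq v$ and $d(u,v)\leqslant 2$. The square chromatic number $\chi_{\square}(G)$ is the minimum such $k$. The square graph $G^2$ is obtained from $G$ by adding an edge between every pair of vertices at distance 2 in $G$; thus $\chi_{\square}(G)=\chi(G^2)$, where $\chi$ is the ordinary chromatic number. Here $\overline{G}^2$ means the square of $\overline{G}$. -}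

module Defs where

open import Data.Nat using (ℕ; _<_)
open import Data.Fin using (Fin)
open import Data.Bool using (Bool; true; false; not)
open import Data.Product using (Σ; _×_; ∃-syntax)
open import Data.Sum using (_⊎_)
open import Relation.Binary.PropositionalEquality using (_≡_; _≢_)
open import Relation.Nullary using (¬_)

record Graph (n : ℕ) : Set where
  field
    adj      : Fin n → Fin n → Bool
    symmetric : ∀ u v → adj u v ≡ adj v u
    irreflexive : ∀ v → adj v v ≡ false
open Graph public

Adj : ∀ {n} → Graph n → Fin n → Fin n → Set
Adj G u v = adj G u v ≡ true

complement : ∀ {n} → Graph n → Graph n
complement {n} G = record
  { adj = λ u v → adjC u v
  ; symmetric = sym'
  ; irreflexive = irr }
  where
  open import Data.Fin using (_≟_)
  open import Relation.Nullary using (yes; no)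
  open import Relation.Binary.PropositionalEquality using (refl; sym)
  adjC : Fin n → Fin n → Bool
  adjC u v with u ≟ v
  ... | yes _ = false
  ... | no _  = not (adj G u v)
  sym' : ∀ u v → adjC u v ≡ adjC v u
  sym' u v with u ≟ v | v ≟ u
  ... | yes _ | yes _ = refl
  ... | yes p | no q = Data.Empty.⊥-elim (q (sym p))
    where import Data.Empty
  ... | no p | yes q = Data.Empty.⊥-elim (p (sym q))
    where import Data.Empty
  ... | no _ | no _ rewrite symmetric G u v = refl
  irr : ∀ v → adjC v v ≡ false
  irr v with v ≟ v
  ... | yes _ = refl
  ... | no p = Data.Empty.⊥-elim (p refl)
    where import Data.Empty

DistAtMost2 : ∀ {n} → Graph n → Fin n → Fin n → Set
DistAtMost2 G u v = Adj G u v ⊎ (∃[ w ] (Adj G u w × Adj G w v))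

IsSquareColoring : ∀ {n} → Graph n → (k : ℕ) → (Fin n → Fin k) → Set
IsSquareColoring G k f = ∀ u v → u ≢ v → DistAtMost2 G u v → f u ≢ f v

SquareColorable : ∀ {n} → Graph n → ℕ → Set
SquareColorable G k = Σ (Fin _ → Fin k) (IsSquareColoring G k)

IsSquareChromaticNumber : ∀ {n} → Graph n → ℕ → Set
IsSquareChromaticNumber G k = SquareColorable G k × (∀ j → j < k → ¬ SquareColorable G j)

module Submission where

-- Upper bound: distinct vertices always receive distinct colours under the
-- identity map, so χ□(H) ≤ n for every graph H of order n.
--
-- Lower bound: call a vertex v *shared* under a colouring f when some other
-- vertex has the colour of v.  The graph-theoretic heart of the proof is
-- `shared⇒private`: if f₁ square-colours G and f₂ square-colours Ḡ, then a
-- vertex shared under f₁ is not shared under f₂.  (If f₁ a = f₁ b, then a, b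
-- are non-adjacent in G with no common G-neighbour; any y with f₂ y = f₂ a is
-- then at distance ≤ 2 from a in G or in Ḡ.)  The rest is pure counting
-- (`Counting`): whenever two colourings satisfy that exclusion property, coding
-- each vertex by its f₂-colour if it is f₁-shared and by its f₁-colour
-- otherwise is injective into Fin k₁ ⊎ Fin k₂ and misses the f₁-colour of any
-- shared vertex, giving n + 1 ≤ k₁ + k₂; without shared vertices f₁ is
-- injective and n ≤ k₁, while k₂ ≥ 1.

open import Defs
open import Data.Nat using (ℕ; suc; _+_; _*_; _≤_; _<_; s≤s; z≤n)
open import Data.Nat.Properties using (+-comm; +-mono-≤; +-identityʳ; ≤-<-connex; module ≤-Reasoning)
open import Data.Fin using (Fin; _≟_; join; splitAt; punchOut; fromℕ<)
open import Data.Fin.Properties using (any?; injective⇒≤; splitAt-join; punchOut-injective)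
open import Data.Product using (_×_; _,_; ∃-syntax)
open import Data.Sum using (_⊎_; inj₁; inj₂)
open import Data.Sum.Properties using (inj₁-injective; inj₂-injective)
open import Data.Bool using (true; false)
open import Data.Empty using (⊥; ⊥-elim)
open import Function.Definitions using (Injective)
open import Relation.Nullary using (¬_; Dec; yes; no)
open import Relation.Nullary.Decidable using (¬?; _×-dec_)
open import Relation.Binary.PropositionalEquality

join-injective : ∀ m n → Injective _≡_ _≡_ (join m n)
join-injective m n {i} {j} eq = begin
  i                         ≡⟨ sym (splitAt-join m n i) ⟩
  splitAt m (join m n i)    ≡⟨ cong (splitAt m) eq ⟩
  splitAt m (join m n j)    ≡⟨ splitAt-join m n j ⟩
  j                         ∎
  where open ≡-Reasoning

-- An injection Fin n → Fin m that misses some value forces n < m: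
-- removing the missed value (punchOut) leaves an injection into Fin (m - 1).
missing⇒< : ∀ {n m} {f : Fin n → Fin m} → Injective _≡_ _≡_ f
          → (c : Fin m) → (∀ v → c ≢ f v) → n < m
missing⇒< {m = suc _} {f} f-inj c misses =
  s≤s (injective⇒≤ (λ {u} {v} eq → f-inj (punchOut-injective (misses u) (misses v) eq)))

Shared : ∀ {n k} → (Fin n → Fin k) → Fin n → Set
Shared f v = ∃[ w ] (w ≢ v × f w ≡ f v)

shared? : ∀ {n k} (f : Fin n → Fin k) v → Dec (Shared f v)
shared? f v = any? (λ w → ¬? (w ≟ v) ×-dec (f w ≟ f v))

unshared⇒injective : ∀ {n k} (f : Fin n → Fin k)
                   → (∀ v → ¬ Shared f v) → Injective _≡_ _≡_ f
unshared⇒injective f none {u} {v} fu≡fv with u ≟ v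
... | yes u≡v = u≡v
... | no u≢v  = ⊥-elim (none v (u , u≢v , fu≡fv))

module Counting {n k₁ k₂ : ℕ} (f₁ : Fin n → Fin k₁) (f₂ : Fin n → Fin k₂)
                (exclusive : ∀ v → Shared f₁ v → ¬ Shared f₂ v) where

  code : Fin n → Fin k₁ ⊎ Fin k₂
  code v with shared? f₁ v
  ... | yes _ = inj₂ (f₂ v)
  ... | no _  = inj₁ (f₁ v)

  code-injective : Injective _≡_ _≡_ code
  code-injective {u} {v} eq with shared? f₁ u | shared? f₁ v | u ≟ v
  ... | _ | _ | yes u≡v = u≡v
  code-injective {u} {v} eq | yes sh | yes _ | no u≢v =
    ⊥-elim (exclusive u sh (v , (λ v≡u → u≢v (sym v≡u)) , sym (inj₂-injective eq)))
  code-injective {u} {v} eq | no ¬sh | no _ | no u≢v =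
    ⊥-elim (¬sh (v , (λ v≡u → u≢v (sym v≡u)) , sym (inj₁-injective eq)))
  code-injective () | yes _ | no _  | no _
  code-injective () | no _  | yes _ | no _

  -- The f₁-colour of a shared vertex a is a code of no vertex: vertices of
  -- that colour are themselves shared, hence coded on the f₂ side.
  code-misses : ∀ a → Shared f₁ a → ∀ v → inj₁ (f₁ a) ≢ code v
  code-misses a (b , b≢a , fb≡fa) v eq with shared? f₁ v
  code-misses a (b , b≢a , fb≡fa) v () | yes _
  code-misses a (b , b≢a , fb≡fa) v eq | no ¬sh with v ≟ a
  ... | yes refl = ¬sh (b , b≢a , fb≡fa)
  ... | no v≢a   = ¬sh (a , (λ a≡v → v≢a (sym a≡v)) , inj₁-injective eq)

  lower-bound : 1 ≤ n → suc n ≤ k₁ + k₂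
  lower-bound n≥1 with any? (shared? f₁)
  ... | yes (a , sh) =
    missing⇒< (λ eq → code-injective (join-injective k₁ k₂ eq))
              (join k₁ k₂ (inj₁ (f₁ a)))
              (λ v eq → code-misses a sh v (join-injective k₁ k₂ eq))
  ... | no none = begin
    suc n     ≡⟨ +-comm 1 n ⟩
    n + 1     ≤⟨ +-mono-≤ (injective⇒≤ (unshared⇒injective f₁ λ v sh → none (v , sh)))
                          (colours-nonempty (f₂ (fromℕ< n≥1))) ⟩
    k₁ + k₂   ∎
    where
    open ≤-Reasoning
    colours-nonempty : ∀ {k} → Fin k → 1 ≤ k
    colours-nonempty {suc _} _ = s≤s z≤n

adjacent-in-G-or-complement : ∀ {n} (G : Graph n) {u v : Fin n}
                            → u ≢ v → Adj G u v ⊎ Adj (complement G) u v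
adjacent-in-G-or-complement G {u} {v} u≢v with u ≟ v
... | yes u≡v = ⊥-elim (u≢v u≡v)
... | no _ with adj G u v
...   | true  = inj₁ refl
...   | false = inj₂ refl

shared⇒private : ∀ {n k₁ k₂} (G : Graph n)
               {f₁ : Fin n → Fin k₁} {f₂ : Fin n → Fin k₂}
               → IsSquareColoring G k₁ f₁ → IsSquareColoring (complement G) k₂ f₂
               → ∀ a → Shared f₁ a → ¬ Shared f₂ a
shared⇒private G {f₁} {f₂} c₁ c₂ a (b , b≢a , fb≡fa) (y , y≢a , gy≡ga) =
  by-adjacency-of-y (adjacent-in-G-or-complement G a≢y)
  where
  a≢b : a ≢ b
  a≢b a≡b = b≢a (sym a≡b)
  a≢y : a ≢ y
  a≢y a≡y = y≢a (sym a≡y)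

  a~̄b : Adj (complement G) a b
  a~̄b with adjacent-in-G-or-complement G a≢b
  ... | inj₁ a~b = ⊥-elim (c₁ a b a≢b (inj₁ a~b) (sym fb≡fa))
  ... | inj₂ a~̄b = a~̄b

  -- f₂ a = f₂ y, so a and y are at distance ≥ 3 in Ḡ; in particular a ~ y in G.
  -- Then y ≠ b, and the edge b y lies in G (path a y b) or in Ḡ (path a b y).
  by-adjacency-of-y : Adj G a y ⊎ Adj (complement G) a y → ⊥
  by-adjacency-of-y (inj₂ a~̄y) = c₂ a y a≢y (inj₁ a~̄y) (sym gy≡ga)
  by-adjacency-of-y (inj₁ a~y) with b ≟ y
  ... | yes b≡y = c₁ a b a≢b (inj₁ (subst (Adj G a) (sym b≡y) a~y)) (sym fb≡fa)
  ... | no b≢y with adjacent-in-G-or-complement G b≢y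
  ...   | inj₁ b~y = c₁ a b a≢b (inj₂ (y , a~y , trans (symmetric G y b) b~y)) (sym fb≡fa)
  ...   | inj₂ b~̄y = c₂ a y a≢y (inj₂ (b , a~̄b , b~̄y)) (sym gy≡ga)

square-chromatic-≤-order : ∀ {n} (H : Graph n) k → IsSquareChromaticNumber H k → k ≤ n
square-chromatic-≤-order {n} H k (_ , minimal) with ≤-<-connex k n
... | inj₁ k≤n = k≤n
... | inj₂ n<k = ⊥-elim (minimal n n<k ((λ v → v) , λ u v u≢v _ u≡v → u≢v u≡v))

theorem8 : (n : ℕ) (G : Graph n) (k₁ k₂ : ℕ)
    → 1 ≤ n
    → IsSquareChromaticNumber G k₁
    → IsSquareChromaticNumber (complement G) k₂
    → (suc n ≤ k₁ + k₂) × (k₁ + k₂ ≤ 2 * n)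
theorem8 n G k₁ k₂ n≥1 χ₁@((f₁ , c₁) , _) χ₂@((f₂ , c₂) , _) =
  lower-bound n≥1 , upper-bound
  where
  open Counting f₁ f₂ (shared⇒private G c₁ c₂) using (lower-bound)
  upper-bound : k₁ + k₂ ≤ 2 * n
  upper-bound = subst (k₁ + k₂ ≤_) (cong (n +_) (sym (+-identityʳ n)))
    (+-mono-≤ (square-chromatic-≤-order G k₁ χ₁) (square-chromatic-≤-order (complement G) k₂ χ₂))
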